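{- For every birth type $\mathbf u\in\mathcal U_\iota$ and every integer $m\ge1$, the number $B_{\mathbf u}(m)$ of vertices born in generation $m$ with birth type $\mathbf u$ satisfies $B_{\mathbf u}(m)=\boldsymbol\xi_\iota\mathbf M^{m-1}\mathbf b_{\mathbf u}^{\top}$.
   Context: EIGS: $K\ge1$ colours; for $i\in[K]$, $R_i$ is a finite connected directed graph with edges coloured in $[K]$ and planting vertices $\beta_i^+,\beta_i^-$. $\Xi_\iota^0$ is a single directed edge of colour $\iota$; $\Xi_\iota^{n+1}$ replaces each edge $(a,b)$ of colour $i$ of $\Xi_\iota^n$ by a fresh copy of $R_i$ with $\beta_i^+=a,\beta_i^-=b$. A vertex is born in generation $m$ if it first appears in $\Xi_\iota^m$, and its birth type is its vector $\boldsymbol\kappa_{\Xi_\iota^m}(v)$, where for a vertex $v$ of a coloured digraph $G$, $\boldsymbol\kappa_G(v)\in\mathbb N^{1\times 2K}$ has entry $2i-1$ = number of outgoing colour-$i$ edges and entry $2i$ = number of incoming colour-$i$ edges at $v$. $\boldsymbol\xi_\iota$ is the $\iota$-th standard basis row vector of $\mathbb R^{1\times K}$. Mass matrix: $[\mathbf M]_{ik}$ = number of colour-$k$ edges of $R_i$. $\mathcal U_\iota=\{\boldsymbol\kappa_{\Xi_\iota^0}(v):v\in V(\Xi_\iota^0)\}\cup\bigcup_{j}\{\boldsymbol\kappa_{R_j}(w):w\in V(R_j)\setminus\{\beta_j^\pm\}\}$, the union over colours $j$ reachable from $\iota$ (i.e. $[\mathbf M^n]_{\iota j}>0$ for some $n\ge0$).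 For $\mathbf u\in\mathcal U_\iota$, $\mathbf b_{\mathbf u}\in\mathbb N^{1\times K}$ is the row vector whose $a$-th entry is the number of vertices $w\in V(R_a)\setminus\{\beta_a^+,\beta_a^-\}$ with $\boldsymbol\kappa_{R_a}(w)=\mathbf u$. -}

module Defs where

open import Data.Nat using (ℕ; zero; suc; _+_; _*_; _∸_; _<_)
import Data.Nat as ℕ
open import Data.Fin as Fin using (Fin; toℕ)
open import Data.List using (List; []; _∷_; _++_; length; filter; map; allFin)
open import Data.List.Membership.Propositional using (_∈_)
open import Data.List.Membership.DecPropositional ℕ._≟_ using (_∈?_)
open import Data.Vec as Vec using (Vec)
open import Data.Vec.Properties using (≡-dec)
open import Data.Product using (Σ; ∃; _×_; _,_; proj₁; proj₂)
open import Data.Sum using (_⊎_)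
open import Relation.Nullary using (¬_; Dec; yes; no)
open import Relation.Nullary.Decidable using (_×-dec_; ¬?)
open import Relation.Binary.PropositionalEquality using (_≡_)
open import Relation.Binary.Definitions using (DecidableEquality)
import Data.Fin.Properties as FinP

-- Edge-coloured directed (multi)graphs with K colours.
-- An edge is (tail , head , colour).

-- Entry 2i-1 (1-based) = number of
-- outgoing colour-i edges at v, entry 2i = number of incoming colour-i edges.
module _ {A : Set} (_≟A_ : DecidableEquality A) {K : ℕ} where

  outDeg : List (A × A × Fin K) → A → Fin K → ℕ
  outDeg es v i =
    length (filter (λ e → (proj₁ e ≟A v) ×-dec (proj₂ (proj₂ e) Fin.≟ i)) es)

  inDeg : List (A × A × Fin K) → A → Fin K → ℕ
  inDeg es v i =
    length (filter (λ e → (proj₁ (proj₂ e) ≟A v) ×-dec (proj₂ (proj₂ e) Fin.≟ i)) es)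

  κ : List (A × A × Fin K) → A → Vec ℕ (K * 2)
  κ es v = Vec.concat (Vec.tabulate (λ i → outDeg es v i Vec.∷ inDeg es v i Vec.∷ Vec.[]))

record CDigraph (K : ℕ) : Set where
  field
    nv    : ℕ
    edges : List (Fin nv × Fin nv × Fin K)

open CDigraph public

data Walk {K : ℕ} (G : CDigraph K) : Fin (nv G) → Fin (nv G) → Set where
  here : ∀ {x} → Walk G x x
  fwd  : ∀ {x y z c} → (x , y , c) ∈ edges G → Walk G y z → Walk G x z
  bwd  : ∀ {x y z c} → (y , x , c) ∈ edges G → Walk G y z → Walk G x z

Connected : ∀ {K} → CDigraph K → Set
Connected G = ∀ x y → Walk G x y

κR : ∀ {K} (G : CDigraph K) → Fin (nv G) → Vec ℕ (K * 2)
κR G = κ Fin._≟_ (edges G)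

record EIGS (K : ℕ) : Set where
  field
    R          : Fin K → CDigraph K
    β⁺ β⁻      : (i : Fin K) → Fin (nv (R i))
    β-distinct : ∀ i → ¬ (β⁺ i ≡ β⁻ i)
    connected  : ∀ i → Connected (R i)

open EIGS public

-- Iterated graphs Ξ_ι^n, with vertices labelled by natural numbers.
-- verts : the list of vertices; edges : coloured edges;
-- fresh : a label strictly larger than all labels used so far.
record LGraph (K : ℕ) : Set where
  field
    verts  : List ℕ
    ledges : List (ℕ × ℕ × Fin K)
    fresh  : ℕ

open LGraph public

module _ {K : ℕ} (S : EIGS K) where

  interior : (i : Fin K) → List (Fin (nv (R S i)))
  interior i = filter (λ w → ¬? (w Fin.≟ β⁺ S i) ×-dec ¬? (w Fin.≟ β⁻ S i)) (allFin (nv (R S i)))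

  place : (i : Fin K) (c a b : ℕ) → Fin (nv (R S i)) → ℕ
  place i c a b w with w Fin.≟ β⁺ S i | w Fin.≟ β⁻ S i
  ... | yes _ | _     = a
  ... | no _  | yes _ = b
  ... | no _  | no _  = c + toℕ w

  placeEdge : (i : Fin K) (c a b : ℕ) → Fin (nv (R S i)) × Fin (nv (R S i)) × Fin K → ℕ × ℕ × Fin K
  placeEdge i c a b (x , y , k) = (place i c a b x , place i c a b y , k)

  substEdges : List (ℕ × ℕ × Fin K) → ℕ → List ℕ × List (ℕ × ℕ × Fin K) × ℕ
  substEdges [] c = [] , [] , c
  substEdges ((a , b , i) ∷ es) c =
    let (vs , fs , c') = substEdges es (c + nv (R S i))
    in  map (place i c a b) (interior i) ++ vs
      , map (placeEdge i c a b) (edges (R S i)) ++ fs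
      , c'

  substStep : LGraph K → LGraph K
  substStep G =
    let (vs , es , c) = substEdges (ledges G) (fresh G)
    in record { verts = verts G ++ vs ; ledges = es ; fresh = c }

  Ξ : Fin K → ℕ → LGraph K
  Ξ ι zero    = record { verts = 0 ∷ 1 ∷ [] ; ledges = (0 , 1 , ι) ∷ [] ; fresh = 2 }
  Ξ ι (suc n) = substStep (Ξ ι n)

  κΞ : Fin K → ℕ → ℕ → Vec ℕ (K * 2)
  κΞ ι m = κ ℕ._≟_ (ledges (Ξ ι m))

  BornIn : Fin K → ℕ → ℕ → Set
  BornIn ι m v = (v ∈ verts (Ξ ι m)) × (∀ (k : Fin m) → ¬ (v ∈ verts (Ξ ι (toℕ k))))

  bornIn? : ∀ ι m v → Dec (BornIn ι m v)
  bornIn? ι m v = (v ∈? verts (Ξ ι m)) ×-dec FinP.all? (λ k → ¬? (v ∈? verts (Ξ ι (toℕ k))))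

  B : Fin K → Vec ℕ (K * 2) → ℕ → ℕ
  B ι u m = length (filter (λ v → bornIn? ι m v ×-dec ≡-dec ℕ._≟_ (κΞ ι m v) u) (verts (Ξ ι m)))

  M : Fin K → Fin K → ℕ
  M i k = length (filter (λ e → proj₂ (proj₂ e) Fin.≟ k) (edges (R S i)))

  bvec : Vec ℕ (K * 2) → Fin K → ℕ
  bvec u a = length (filter (λ w → ≡-dec ℕ._≟_ (κR (R S a) w) u) (interior a))

sumF : ∀ {n} → (Fin n → ℕ) → ℕ
sumF {zero}  f = 0
sumF {suc n} f = f Fin.zero + sumF (λ j → f (Fin.suc j))

matPow : ∀ {K} → (Fin K → Fin K → ℕ) → ℕ → Fin K → Fin K → ℕ
matPow A zero    i k with i Fin.≟ k
... | yes _ = 1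
... | no _  = 0
matPow A (suc n) i k = sumF (λ j → matPow A n i j * A j k)

module _ {K : ℕ} (S : EIGS K) where

  Reachable : Fin K → Fin K → Set
  Reachable ι j = ∃ λ n → 0 < matPow (M S) n ι j

  InU : Fin K → Vec ℕ (K * 2) → Set
  InU ι u =
    (∃ λ v → v ∈ verts (Ξ S ι 0) × κΞ S ι 0 v ≡ u)
    ⊎ (∃ λ j → Reachable ι j × (∃ λ w → w ∈ interior S j × κR (R S j) w ≡ u))

  ξMb : Fin K → ℕ → Vec ℕ (K * 2) → ℕ
  ξMb ι n u = sumF (λ j → matPow (M S) n ι j * bvec S u j)

-- Generation n+1 replaces every colour-i edge of Ξ^n by a fresh copy of R_i, and the vertices born
-- then are exactly the interior vertices of these copies. Each copy gets its own block of labels, so no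
-- other edge touches its interior: an interior vertex w of R_i keeps the birth type κ_{R_i}(w). Hence
-- B_u(n+1) is the sum over the edges of Ξ^n of b_u(colour), and since a colour-i edge begets [M]_{ik}
-- edges of colour k, Ξ^n has [ξ_ι M^n]_j edges of colour j.
module Submission where

open import Defs
open import Data.Nat using (ℕ; zero; suc; _+_; _*_; _∸_; _≤_; _<_; _≤′_; z≤n; s≤s)
import Data.Nat as ℕ
open import Data.Nat.Properties
open import Algebra.Properties.Semiring.Sum +-*-semiring
  using (sum; sum-syntax; sum-cong-≗; sum-replicate-zero; ∑-comm; ∑-distrib-+; *-distribˡ-sum; *-distribʳ-sum)
open import Data.Fin as Fin using (Fin; toℕ)
import Data.Fin.Properties as FinP
open import Data.List as List using (List; []; _∷_; _++_; length; filter; map)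
open import Data.List.Properties
  using (filter-++; filter-none; filter-accept; filter-reject; length-++; map-id; map-∘; map-++; ++-assoc)
open import Data.Nat.ListAction using () renaming (sum to sumᴸ)
open import Data.Nat.ListAction.Properties using (sum-++)
open import Data.List.Relation.Unary.All as All using (All; []; _∷_)
import Data.List.Relation.Unary.All.Properties as AllP
open import Data.List.Membership.Propositional using (_∈_)
open import Data.List.Membership.Propositional.Properties using (∈-filter⁻; ∈-++⁺ʳ)
open import Data.Vec as Vec using (Vec)
open import Data.Vec.Properties using (≡-dec; tabulate-cong)
open import Data.Product using (_×_; _,_; proj₁; proj₂)
open import Data.Sum using (_⊎_; inj₁; inj₂)
open import Function using (_∘_; id; _⇔_; mk⇔; Equivalence)
open import Relation.Nullary using (¬_; yes; no; contradiction)
open import Relation.Nullary.Decidable using (_×-dec_; ¬?)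
open import Relation.Unary using (Decidable)
open import Relation.Binary.Definitions using (DecidableEquality)
open import Relation.Binary.PropositionalEquality

module _ {a p} {A : Set a} {P : A → Set p} (P? : Decidable P) where

  length-filter-++ : ∀ xs ys → length (filter P? (xs ++ ys)) ≡ length (filter P? xs) + length (filter P? ys)
  length-filter-++ xs ys = trans (cong length (filter-++ P? xs ys)) (length-++ (filter P? xs))

module _ {a b p q} {A : Set a} {B : Set b} {P : B → Set p} {Q : A → Set q}
         (P? : Decidable P) (Q? : Decidable Q) where

  length-filter-map : ∀ (f : A → B) {xs} → All (λ x → P (f x) ⇔ Q x) xs →
                      length (filter P? (map f xs)) ≡ length (filter Q? xs)
  length-filter-map f {[]}     []             = refl
  length-filter-map f {x ∷ xs} (Pfx⇔Qx ∷ rest) with P? (f x) | Q? x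
  ... | yes _   | yes _   = cong suc (length-filter-map f rest)
  ... | yes Pfx | no ¬Qx  = contradiction (Equivalence.to Pfx⇔Qx Pfx) ¬Qx
  ... | no ¬Pfx | yes Qx  = contradiction (Equivalence.from Pfx⇔Qx Qx) ¬Pfx
  ... | no _    | no _    = length-filter-map f rest

length-filter-≐ : ∀ {a p q} {A : Set a} {P : A → Set p} {Q : A → Set q} (P? : Decidable P) (Q? : Decidable Q)
                  {xs} → All (λ x → P x ⇔ Q x) xs → length (filter P? xs) ≡ length (filter Q? xs)
length-filter-≐ P? Q? {xs} P⇔Q =
  trans (cong (length ∘ filter P?) (sym (map-id xs))) (length-filter-map P? Q? id P⇔Q)

sumF≡sum : ∀ {n} (f : Fin n → ℕ) → sumF f ≡ sum f
sumF≡sum {zero}  f = refl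
sumF≡sum {suc n} f = cong (f Fin.zero +_) (sumF≡sum (f ∘ Fin.suc))

sum-δ : ∀ {n} (i : Fin n) (g : Fin n → ℕ) → (∀ k → i ≢ k → g k ≡ 0) → sum g ≡ g i
sum-δ {suc n} Fin.zero g g≡0 =
  trans (cong (g Fin.zero +_) (trans (sum-cong-≗ (λ k → g≡0 (Fin.suc k) λ ())) (sum-replicate-zero n)))
        (+-identityʳ _)
sum-δ (Fin.suc i) g g≡0 =
  trans (cong (_+ sum (g ∘ Fin.suc)) (g≡0 Fin.zero λ ()))
        (sum-δ i (g ∘ Fin.suc) (λ k i≢k → g≡0 (Fin.suc k) (i≢k ∘ FinP.suc-injective)))

sum-vecMat-assoc : ∀ {m n} (v : Fin m → ℕ) (A : Fin m → Fin n → ℕ) (f : Fin n → ℕ) →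
                   ∑[ j < m ] (v j * ∑[ k < n ] (A j k * f k)) ≡ ∑[ k < n ] ((∑[ j < m ] (v j * A j k)) * f k)
sum-vecMat-assoc {m} {n} v A f = begin
  ∑[ j < m ] (v j * ∑[ k < n ] (A j k * f k))
    ≡⟨ sum-cong-≗ (λ j → *-distribˡ-sum (v j) (λ k → A j k * f k)) ⟩
  ∑[ j < m ] ∑[ k < n ] (v j * (A j k * f k))
    ≡⟨ ∑-comm (λ j k → v j * (A j k * f k)) ⟩
  ∑[ k < n ] ∑[ j < m ] (v j * (A j k * f k))
    ≡⟨ sum-cong-≗ (λ k → sum-cong-≗ (λ j → sym (*-assoc (v j) (A j k) (f k)))) ⟩
  ∑[ k < n ] ∑[ j < m ] (v j * A j k * f k)
    ≡⟨ sum-cong-≗ (λ k → sym (*-distribʳ-sum (f k) (λ j → v j * A j k))) ⟩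
  ∑[ k < n ] ((∑[ j < m ] (v j * A j k)) * f k) ∎
  where open ≡-Reasoning

matPow-suc : ∀ {K} (A : Fin K → Fin K → ℕ) n i k → matPow A (suc n) i k ≡ ∑[ j < K ] (matPow A n i j * A j k)
matPow-suc A n i k = sumF≡sum (λ j → matPow A n i j * A j k)

matPow-zero-diag : ∀ {K} (A : Fin K → Fin K → ℕ) i → matPow A 0 i i ≡ 1
matPow-zero-diag A i with i Fin.≟ i
... | yes _   = refl
... | no i≢i = contradiction refl i≢i

matPow-zero-off : ∀ {K} (A : Fin K → Fin K → ℕ) {i k} → i ≢ k → matPow A 0 i k ≡ 0
matPow-zero-off A {i} {k} i≢k with i Fin.≟ k
... | yes i≡k = contradiction i≡k i≢k
... | no _    = refl

Edge : Set → ℕ → Set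
Edge A K = A × A × Fin K

colour : ∀ {A K} → Edge A K → Fin K
colour = proj₂ ∘ proj₂

data End : Set where
  tail head : End

endpoint : ∀ {A K} → End → Edge A K → A
endpoint tail = proj₁
endpoint head = proj₁ ∘ proj₂

Ends : ∀ {A K} → (A → Set) → Edge A K → Set
Ends P e = P (endpoint tail e) × P (endpoint head e)

Ends⇒endpoint : ∀ {A K} {P : A → Set} {e : Edge A K} d → Ends P e → P (endpoint d e)
Ends⇒endpoint tail = proj₁
Ends⇒endpoint head = proj₂

mapEnds : ∀ {A B K} → (A → B) → Edge A K → Edge B K
mapEnds f (x , y , k) = f x , f y , k

endpoint-mapEnds : ∀ {A B K} d (f : A → B) (e : Edge A K) → endpoint d (mapEnds f e) ≡ f (endpoint d e)
endpoint-mapEnds tail f e = refl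
endpoint-mapEnds head f e = refl

edgeWeight : ∀ {A K} → (Fin K → ℕ) → List (Edge A K) → ℕ
edgeWeight f L = sumᴸ (map (f ∘ colour) L)

colourCount : ∀ {A K} → List (Edge A K) → Fin K → ℕ
colourCount L k = length (filter (λ e → colour e Fin.≟ k) L)

module _ {A : Set} {K : ℕ} (f : Fin K → ℕ) where

  edgeWeight-++ : ∀ (L L′ : List (Edge A K)) → edgeWeight f (L ++ L′) ≡ edgeWeight f L + edgeWeight f L′
  edgeWeight-++ L L′ = trans (cong sumᴸ (map-++ (f ∘ colour) L L′)) (sum-++ (map (f ∘ colour) L) _)

  edgeWeight-mapEnds : ∀ {B : Set} (g : A → B) L → edgeWeight f (map (mapEnds g) L) ≡ edgeWeight f L
  edgeWeight-mapEnds g L = cong sumᴸ (sym (map-∘ L))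

  ∑-colourCount-singleton : ∀ (e : Edge A K) → ∑[ k < K ] (colourCount (e ∷ []) k * f k) ≡ f (colour e)
  ∑-colourCount-singleton e = trans (sum-δ (colour e) _ off) on
    where
    on : colourCount (e ∷ []) (colour e) * f (colour e) ≡ f (colour e)
    on = trans (cong (λ n → n * f (colour e)) (cong length (filter-accept (λ e′ → colour e′ Fin.≟ colour e) refl)))
               (+-identityʳ (f (colour e)))
    off : ∀ k → colour e ≢ k → colourCount (e ∷ []) k * f k ≡ 0
    off k c≢k = cong (λ n → n * f k) (cong length (filter-reject (λ e′ → colour e′ Fin.≟ k) c≢k))

  edgeWeight-colourCount : ∀ (L : List (Edge A K)) → edgeWeight f L ≡ ∑[ k < K ] (colourCount L k * f k)
  edgeWeight-colourCount []      = sym (sum-replicate-zero K)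
  edgeWeight-colourCount (e ∷ L) = begin
    f (colour e) + edgeWeight f L
      ≡⟨ cong₂ _+_ (sym (∑-colourCount-singleton e)) (edgeWeight-colourCount L) ⟩
    ∑[ k < K ] (colourCount (e ∷ []) k * f k) + ∑[ k < K ] (colourCount L k * f k)
      ≡⟨ ∑-distrib-+ (λ k → colourCount (e ∷ []) k * f k) (λ k → colourCount L k * f k) ⟨
    ∑[ k < K ] (colourCount (e ∷ []) k * f k + colourCount L k * f k)
      ≡⟨ sum-cong-≗ (λ k → sym (*-distribʳ-+ (f k) (colourCount (e ∷ []) k) (colourCount L k))) ⟩
    ∑[ k < K ] ((colourCount (e ∷ []) k + colourCount L k) * f k)
      ≡⟨ sum-cong-≗ (λ k → cong (_* f k) (length-filter-++ (λ e′ → colour e′ Fin.≟ k) (e ∷ []) L)) ⟨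
    ∑[ k < K ] (colourCount (e ∷ L) k * f k) ∎
    where open ≡-Reasoning

-- degree _≟_ tail and degree _≟_ head are, definitionally, outDeg _≟_ and inDeg _≟_.
degree : ∀ {A K} → DecidableEquality A → End → List (Edge A K) → A → Fin K → ℕ
degree _≟_ d L v k = length (filter (λ e → (endpoint d e ≟ v) ×-dec (colour e Fin.≟ k)) L)

κ-cong : ∀ {A B K} (_≟A_ : DecidableEquality A) (_≟B_ : DecidableEquality B)
         (L : List (Edge A K)) (L′ : List (Edge B K)) v w →
         (∀ d k → degree _≟A_ d L v k ≡ degree _≟B_ d L′ w k) → κ _≟A_ L v ≡ κ _≟B_ L′ w
κ-cong _ _ _ _ _ _ deg≡ =
  cong Vec.concat (tabulate-cong (λ k → cong₂ (λ o i → o Vec.∷ i Vec.∷ Vec.[]) (deg≡ tail k) (deg≡ head k)))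

module _ {A : Set} (_≟_ : DecidableEquality A) {K : ℕ} where

  degree-sandwich : ∀ d {v} {Γ L Δ : List (Edge A K)} →
                    All (Ends (_≢ v)) Γ → All (Ends (_≢ v)) Δ →
                    ∀ k → degree _≟_ d (Γ ++ L ++ Δ) v k ≡ degree _≟_ d L v k
  degree-sandwich d {v} {Γ} {L} {Δ} Γ≢v Δ≢v k = begin
    length (filter P? (Γ ++ L ++ Δ))                   ≡⟨ length-filter-++ P? Γ (L ++ Δ) ⟩
    length (filter P? Γ) + length (filter P? (L ++ Δ)) ≡⟨ cong (_+ length (filter P? (L ++ Δ))) (none Γ≢v) ⟩
    length (filter P? (L ++ Δ))                        ≡⟨ length-filter-++ P? L Δ ⟩
    length (filter P? L) + length (filter P? Δ)        ≡⟨ cong (length (filter P? L) +_) (none Δ≢v) ⟩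
    length (filter P? L) + 0                           ≡⟨ +-identityʳ _ ⟩
    length (filter P? L)                               ∎
    where
    open ≡-Reasoning
    P? = λ (e : Edge A K) → (endpoint d e ≟ v) ×-dec (colour e Fin.≟ k)
    none : ∀ {Λ} → All (Ends (_≢ v)) Λ → length (filter P? Λ) ≡ 0
    none Λ≢v =
      cong length (filter-none P? (All.map (λ e≢v (e≡v , _) → Ends⇒endpoint {P = _≢ v} d e≢v e≡v) Λ≢v))

  κ-sandwich : ∀ {v} {Γ L Δ : List (Edge A K)} → All (Ends (_≢ v)) Γ → All (Ends (_≢ v)) Δ →
               κ _≟_ (Γ ++ L ++ Δ) v ≡ κ _≟_ L v
  κ-sandwich {v} {Γ} {L} {Δ} Γ≢v Δ≢v =
    κ-cong _≟_ _≟_ (Γ ++ L ++ Δ) L v v (λ d → degree-sandwich d Γ≢v Δ≢v)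

  degree-mapEnds : ∀ {B : Set} (_≟B_ : DecidableEquality B) d (f : A → B) {w} → (∀ x → f x ≡ f w → x ≡ w) →
                   ∀ (L : List (Edge A K)) k → degree _≟B_ d (map (mapEnds f) L) (f w) k ≡ degree _≟_ d L w k
  degree-mapEnds _≟B_ d f {w} f⁻¹w L k =
    length-filter-map (λ e → (endpoint d e ≟B f w) ×-dec (colour e Fin.≟ k))
                      (λ e → (endpoint d e ≟ w) ×-dec (colour e Fin.≟ k)) (mapEnds f)
                      (All.universal (λ e → mk⇔ (λ (fe≡fw , c) → f⁻¹w _ (trans (sym (f-end e)) fe≡fw) , c)
                                                (λ (e≡w , c) → trans (f-end e) (cong f e≡w) , c)) L)
    where
    f-end : ∀ e → endpoint d (mapEnds f e) ≡ f (endpoint d e)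
    f-end = endpoint-mapEnds d f

  κ-mapEnds : ∀ {B : Set} (_≟B_ : DecidableEquality B) (f : A → B) {w} → (∀ x → f x ≡ f w → x ≡ w) →
              ∀ (L : List (Edge A K)) → κ _≟B_ (map (mapEnds f) L) (f w) ≡ κ _≟_ L w
  κ-mapEnds _≟B_ f {w} f⁻¹w L =
    κ-cong _≟B_ _≟_ (map (mapEnds f) L) L (f w) w (λ d → degree-mapEnds _≟B_ d f f⁻¹w L)

module _ {K : ℕ} (S : EIGS K) where

  newVerts : List (Edge ℕ K) → ℕ → List ℕ
  newVerts es c = proj₁ (substEdges S es c)

  newEdges : List (Edge ℕ K) → ℕ → List (Edge ℕ K)
  newEdges es c = proj₁ (proj₂ (substEdges S es c))

  nextFresh : List (Edge ℕ K) → ℕ → ℕ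
  nextFresh es c = proj₂ (proj₂ (substEdges S es c))

  ≤-nextFresh : ∀ es c → c ≤ nextFresh es c
  ≤-nextFresh []                 c = ≤-refl
  ≤-nextFresh ((_ , _ , i) ∷ es) c = ≤-trans (m≤m+n c _) (≤-nextFresh es (c + nv (R S i)))

  interior⇒non-planting : ∀ i {w} → w ∈ interior S i → w ≢ β⁺ S i × w ≢ β⁻ S i
  interior⇒non-planting i =
    proj₂ ∘ ∈-filter⁻ (λ w → ¬? (w Fin.≟ β⁺ S i) ×-dec ¬? (w Fin.≟ β⁻ S i)) {xs = List.allFin _}

  module _ (i : Fin K) (c a b : ℕ) where

    place-non-planting : ∀ {w} → w ≢ β⁺ S i → w ≢ β⁻ S i → place S i c a b w ≡ c + toℕ w
    place-non-planting {w} w≢β⁺ w≢β⁻ with w Fin.≟ β⁺ S i | w Fin.≟ β⁻ S i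
    ... | yes w≡β⁺ | _        = contradiction w≡β⁺ w≢β⁺
    ... | no _     | yes w≡β⁻ = contradiction w≡β⁻ w≢β⁻
    ... | no _     | no _     = refl

    place-interior : ∀ {w} → w ∈ interior S i → place S i c a b w ≡ c + toℕ w
    place-interior w∈ = let w≢β⁺ , w≢β⁻ = interior⇒non-planting i w∈ in place-non-planting w≢β⁺ w≢β⁻

    place-range : ∀ {b₀} → a < b₀ → b < b₀ → ∀ x →
                  place S i c a b x < b₀ ⊎ (c ≤ place S i c a b x × place S i c a b x < c + nv (R S i))
    place-range a<b₀ b<b₀ x with x Fin.≟ β⁺ S i | x Fin.≟ β⁻ S i
    ... | yes _ | _     = inj₁ a<b₀
    ... | no _  | yes _ = inj₁ b<b₀
    ... | no _  | no _  = inj₂ (m≤m+n c (toℕ x) , +-monoʳ-< c (FinP.toℕ<n x))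

    place-injective-at : a < c → b < c → ∀ w x → place S i c a b x ≡ c + toℕ w → x ≡ w
    place-injective-at a<c b<c w x eq with x Fin.≟ β⁺ S i | x Fin.≟ β⁻ S i
    ... | yes _ | _     = contradiction eq (<⇒≢ (<-≤-trans a<c (m≤m+n c (toℕ w))))
    ... | no _  | yes _ = contradiction eq (<⇒≢ (<-≤-trans b<c (m≤m+n c (toℕ w))))
    ... | no _  | no _  = FinP.toℕ-injective (+-cancelˡ-≡ c _ _ eq)

    place-interior-range : ∀ {w} → w ∈ interior S i → c ≤ place S i c a b w × place S i c a b w < c + nv (R S i)
    place-interior-range {w} w∈ rewrite place-interior w∈ = m≤m+n c _ , +-monoʳ-< c (FinP.toℕ<n w)

    placeEdges-bounded : a < c → b < c → All (Ends (_< c + nv (R S i))) (map (placeEdge S i c a b) (edges (R S i)))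
    placeEdges-bounded a<c b<c = AllP.map⁺ (All.universal (λ e → bounded (proj₁ e) , bounded (proj₁ (proj₂ e))) _)
      where
      bounded : ∀ x → place S i c a b x < c + nv (R S i)
      bounded x with place-range a<c b<c x
      ... | inj₁ x<c        = <-≤-trans x<c (m≤m+n c _)
      ... | inj₂ (_ , x<c+) = x<c+

  κ-copy : ∀ i c a b {w} → a < c → b < c → w ∈ interior S i → {Γ Δ : List (Edge ℕ K)} →
           All (Ends (_≢ place S i c a b w)) Γ → All (Ends (_≢ place S i c a b w)) Δ →
           κ ℕ._≟_ (Γ ++ map (placeEdge S i c a b) (edges (R S i)) ++ Δ) (place S i c a b w) ≡ κR (R S i) w
  κ-copy i c a b {w} a<c b<c w∈ Γ≢ Δ≢ =
    trans (κ-sandwich ℕ._≟_ Γ≢ Δ≢)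
          (κ-mapEnds Fin._≟_ ℕ._≟_ (place S i c a b)
                     (λ x eq → place-injective-at i c a b a<c b<c w x (trans eq (place-interior i c a b w∈)))
                     (edges (R S i)))

  newVerts-range : ∀ es c → All (λ v → c ≤ v × v < nextFresh es c) (newVerts es c)
  newVerts-range []                 c = []
  newVerts-range ((a , b , i) ∷ es) c =
    AllP.++⁺ (AllP.map⁺ (All.tabulate copy))
             (All.map (λ (d≤v , v<c′) → ≤-trans (m≤m+n c _) d≤v , v<c′) (newVerts-range es d))
    where
    d = c + nv (R S i)
    copy : ∀ {w} → w ∈ interior S i → c ≤ place S i c a b w × place S i c a b w < nextFresh es d
    copy w∈ = let c≤v , v<d = place-interior-range i c a b w∈ in c≤v , <-≤-trans v<d (≤-nextFresh es d)

  newEdges-ends : ∀ es c {b₀} → b₀ ≤ c → All (Ends (_< b₀)) es →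
                  All (Ends (λ x → x < b₀ ⊎ (c ≤ x × x < nextFresh es c))) (newEdges es c)
  newEdges-ends []                 c b₀≤c []                    = []
  newEdges-ends ((a , b , i) ∷ es) c {b₀} b₀≤c ((a<b₀ , b<b₀) ∷ es<b₀) =
    AllP.++⁺ (AllP.map⁺ (All.universal (λ e → copy (proj₁ e) , copy (proj₁ (proj₂ e))) _))
             (All.map (λ (x , y) → shift x , shift y) (newEdges-ends es d (≤-trans b₀≤c (m≤m+n c _)) es<b₀))
    where
    d  = c + nv (R S i)
    c′ = nextFresh es d
    copy : ∀ x → place S i c a b x < b₀ ⊎ (c ≤ place S i c a b x × place S i c a b x < c′)
    copy x with place-range i c a b a<b₀ b<b₀ x
    ... | inj₁ old         = inj₁ old
    ... | inj₂ (c≤y , y<d) = inj₂ (c≤y , <-≤-trans y<d (≤-nextFresh es d))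
    shift : ∀ {x} → x < b₀ ⊎ (d ≤ x × x < c′) → x < b₀ ⊎ (c ≤ x × x < c′)
    shift (inj₁ old)          = inj₁ old
    shift (inj₂ (d≤x , x<c′)) = inj₂ (≤-trans (m≤m+n c _) d≤x , x<c′)

  module _ (u : Vec ℕ (K * 2)) where

    HasType : List (Edge ℕ K) → ℕ → Set
    HasType L v = κ ℕ._≟_ L v ≡ u

    hasType? : ∀ L → Decidable (HasType L)
    hasType? L v = ≡-dec ℕ._≟_ (κ ℕ._≟_ L v) u

    -- Γ holds the copies already laid out for earlier edges; all their labels are below c.
    count-newVerts : ∀ es c (Γ : List (Edge ℕ K)) → All (Ends (_< c)) es → All (Ends (_< c)) Γ →
                     length (filter (hasType? (Γ ++ newEdges es c)) (newVerts es c)) ≡ edgeWeight (bvec S u) es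
    count-newVerts []                 c Γ []                   Γ<c = refl
    count-newVerts ((a , b , i) ∷ es) c Γ ((a<c , b<c) ∷ es<c) Γ<c = begin
      length (filter P? (copyVerts ++ newVerts es d))                   ≡⟨ length-filter-++ P? copyVerts _ ⟩
      length (filter P? copyVerts) + length (filter P? (newVerts es d)) ≡⟨ cong₂ _+_ copies rest ⟩
      bvec S u i + edgeWeight (bvec S u) es                             ∎
      where
      open ≡-Reasoning
      d = c + nv (R S i)
      copyEdges = map (placeEdge S i c a b) (edges (R S i))
      copyVerts = map (place S i c a b) (interior S i)
      P? = hasType? (Γ ++ copyEdges ++ newEdges es d)
      weaken : ∀ {L : List (Edge ℕ K)} → All (Ends (_< c)) L → All (Ends (_< d)) L
      weaken = All.map (λ (x<c , y<c) → <-≤-trans x<c (m≤m+n c _) , <-≤-trans y<c (m≤m+n c _))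
      κ-copyVert : ∀ {w} → w ∈ interior S i → κ ℕ._≟_ (Γ ++ copyEdges ++ newEdges es d) (place S i c a b w) ≡ κR (R S i) w
      κ-copyVert {w} w∈ = κ-copy i c a b a<c b<c w∈ (All.map (λ (x , y) → old x , old y) Γ<c)
                                 (All.map (λ (x , y) → outside x , outside y) (newEdges-ends es d (m≤m+n c _) es<c))
        where
        v = place S i c a b w
        old : ∀ {x} → x < c → x ≢ v
        old x<c refl = <⇒≱ x<c (proj₁ (place-interior-range i c a b w∈))
        outside : ∀ {x} → x < c ⊎ (d ≤ x × x < nextFresh es d) → x ≢ v
        outside (inj₁ x<c)      = old x<c
        outside (inj₂ (d≤x , _)) refl = <⇒≱ (proj₂ (place-interior-range i c a b w∈)) d≤x
      copies : length (filter P? copyVerts) ≡ bvec S u i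
      copies = length-filter-map P? (λ w → ≡-dec ℕ._≟_ (κR (R S i) w) u) (place S i c a b)
                 (All.tabulate (λ w∈ → mk⇔ (trans (sym (κ-copyVert w∈))) (trans (κ-copyVert w∈))))
      rest : length (filter P? (newVerts es d)) ≡ edgeWeight (bvec S u) es
      rest = trans (cong (λ L → length (filter (hasType? L) (newVerts es d))) (sym (++-assoc Γ copyEdges _)))
                   (count-newVerts es d (Γ ++ copyEdges) (weaken es<c)
                                   (AllP.++⁺ (weaken Γ<c) (placeEdges-bounded i c a b a<c b<c)))

  edgeWeight-newEdges : ∀ f es c → edgeWeight f (newEdges es c) ≡ edgeWeight (λ i → edgeWeight f (edges (R S i))) es
  edgeWeight-newEdges f []                 c = refl
  edgeWeight-newEdges f ((a , b , i) ∷ es) c =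
    trans (edgeWeight-++ f (map (placeEdge S i c a b) (edges (R S i))) _)
          (cong₂ _+_ (edgeWeight-mapEnds f (place S i c a b) (edges (R S i)))
                     (edgeWeight-newEdges f es (c + nv (R S i))))

  module _ (ι : Fin K) where

    edgeWeight-Ξ : ∀ n f → edgeWeight f (ledges (Ξ S ι n)) ≡ ∑[ j < K ] (matPow (M S) n ι j * f j)
    edgeWeight-Ξ zero    f =
      sym (trans (sum-δ ι _ (λ k ι≢k → cong (_* f k) (matPow-zero-off (M S) ι≢k)))
                 (cong (_* f ι) (matPow-zero-diag (M S) ι)))
    edgeWeight-Ξ (suc n) f = begin
      edgeWeight f (newEdges (ledges (Ξ S ι n)) (fresh (Ξ S ι n)))
        ≡⟨ edgeWeight-newEdges f (ledges (Ξ S ι n)) (fresh (Ξ S ι n)) ⟩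
      edgeWeight (λ i → edgeWeight f (edges (R S i))) (ledges (Ξ S ι n))
        ≡⟨ edgeWeight-Ξ n _ ⟩
      ∑[ j < K ] (matPow (M S) n ι j * edgeWeight f (edges (R S j)))
        ≡⟨ sum-cong-≗ (λ j → cong (matPow (M S) n ι j *_) (edgeWeight-colourCount f (edges (R S j)))) ⟩
      ∑[ j < K ] (matPow (M S) n ι j * ∑[ k < K ] (M S j k * f k))
        ≡⟨ sum-vecMat-assoc (matPow (M S) n ι) (M S) f ⟩
      ∑[ k < K ] ((∑[ j < K ] (matPow (M S) n ι j * M S j k)) * f k)
        ≡⟨ sum-cong-≗ (λ k → cong (_* f k) (matPow-suc (M S) n ι k)) ⟨
      ∑[ k < K ] (matPow (M S) (suc n) ι k * f k) ∎
      where open ≡-Reasoning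

    ledges-bounded : ∀ n → All (Ends (_< fresh (Ξ S ι n))) (ledges (Ξ S ι n))
    ledges-bounded zero    = (s≤s z≤n , s≤s (s≤s z≤n)) ∷ []
    ledges-bounded (suc n) = All.map (λ (x , y) → below x , below y) (newEdges-ends es c ≤-refl (ledges-bounded n))
      where
      es = ledges (Ξ S ι n)
      c  = fresh (Ξ S ι n)
      below : ∀ {x} → x < c ⊎ (c ≤ x × x < nextFresh es c) → x < nextFresh es c
      below (inj₁ x<c)       = <-≤-trans x<c (≤-nextFresh es c)
      below (inj₂ (_ , x<c′)) = x<c′

    verts-bounded : ∀ n → All (_< fresh (Ξ S ι n)) (verts (Ξ S ι n))
    verts-bounded zero    = s≤s z≤n ∷ s≤s (s≤s z≤n) ∷ []
    verts-bounded (suc n) =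
      AllP.++⁺ (All.map (λ v<c → <-≤-trans v<c (≤-nextFresh es c)) (verts-bounded n))
               (All.map proj₂ (newVerts-range es c))
      where
      es = ledges (Ξ S ι n)
      c  = fresh (Ξ S ι n)

    fresh-mono : ∀ {m n} → m ≤′ n → fresh (Ξ S ι m) ≤ fresh (Ξ S ι n)
    fresh-mono ℕ.≤′-refl     = ≤-refl
    fresh-mono {n = suc n} (ℕ.≤′-step p) =
      ≤-trans (fresh-mono p) (≤-nextFresh (ledges (Ξ S ι n)) (fresh (Ξ S ι n)))

    old-not-born : ∀ {n v} → v ∈ verts (Ξ S ι n) → ¬ BornIn S ι (suc n) v
    old-not-born {n} {v} v∈ (_ , unborn) =
      unborn (Fin.fromℕ n) (subst (λ t → v ∈ verts (Ξ S ι t)) (sym (FinP.toℕ-fromℕ n)) v∈)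

    new-born : ∀ {n v} → v ∈ newVerts (ledges (Ξ S ι n)) (fresh (Ξ S ι n)) → BornIn S ι (suc n) v
    new-born {n} {v} v∈ = ∈-++⁺ʳ (verts (Ξ S ι n)) v∈ , unborn
      where
      unborn : ∀ (k : Fin (suc n)) → ¬ v ∈ verts (Ξ S ι (toℕ k))
      unborn k v∈k =
        <⇒≱ (<-≤-trans (All.lookup (verts-bounded (toℕ k)) v∈k) (fresh-mono (≤⇒≤′ (FinP.toℕ≤pred[n] k))))
            (proj₁ (All.lookup (newVerts-range (ledges (Ξ S ι n)) (fresh (Ξ S ι n))) v∈))

    B-suc : ∀ u n → B S ι u (suc n) ≡
                    length (filter (hasType? u (newEdges (ledges (Ξ S ι n)) (fresh (Ξ S ι n))))
                                   (newVerts (ledges (Ξ S ι n)) (fresh (Ξ S ι n))))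
    B-suc u n = begin
      length (filter born? (verts (Ξ S ι n) ++ vs))
        ≡⟨ length-filter-++ born? (verts (Ξ S ι n)) vs ⟩
      length (filter born? (verts (Ξ S ι n))) + length (filter born? vs)
        ≡⟨ cong₂ _+_ none-old all-new ⟩
      length (filter (hasType? u es′) vs) ∎
      where
      open ≡-Reasoning
      vs  = newVerts (ledges (Ξ S ι n)) (fresh (Ξ S ι n))
      es′ = newEdges (ledges (Ξ S ι n)) (fresh (Ξ S ι n))
      born? = λ v → bornIn? S ι (suc n) v ×-dec hasType? u es′ v
      none-old : length (filter born? (verts (Ξ S ι n))) ≡ 0
      none-old = cong length (filter-none born? (All.tabulate λ v∈ → old-not-born v∈ ∘ proj₁))
      all-new : length (filter born? vs) ≡ length (filter (hasType? u es′) vs)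
      all-new = length-filter-≐ born? (hasType? u es′) (All.tabulate λ v∈ → mk⇔ proj₂ (new-born v∈ ,_))

lemma4p5 : (K : ℕ) → 1 ≤ K → (S : EIGS K) → (ι : Fin K) → (u : Vec ℕ (K * 2)) → InU S ι u
    → (m : ℕ) → 1 ≤ m → B S ι u m ≡ ξMb S ι (m ∸ 1) u
lemma4p5 K _ S ι u _ (suc n) _ = begin
  B S ι u (suc n)                              ≡⟨ B-suc S ι u n ⟩
  length (filter (hasType? S u es′) vs)        ≡⟨ count-newVerts S u es c [] (ledges-bounded S ι n) [] ⟩
  edgeWeight (bvec S u) es                     ≡⟨ edgeWeight-Ξ S ι n (bvec S u) ⟩
  ∑[ j < K ] (matPow (M S) n ι j * bvec S u j) ≡⟨ sumF≡sum (λ j → matPow (M S) n ι j * bvec S u j) ⟨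
  ξMb S ι n u                                  ∎
  where
  open ≡-Reasoning
  es  = ledges (Ξ S ι n)
  c   = fresh (Ξ S ι n)
  vs  = newVerts S es c
  es′ = newEdges S es c
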